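{- Let $n\ge 13$, let $Q$ be a query graph on an $n$-element vertex set $V$ with minimum degree at least $n-3$, and suppose the answers $q(x,y)$ to all pairs $xy\in E(Q)$ have been received for some hidden tree on $V$. If $T_0$ and $T_1$ are consistent trees and $a,b,c,d$ are vertices such that $abcd$ is a path in $T_0$ (edges $ab,bc,cd$) and $dabc$ is a path in $T_1$ (edges $da,ab,bc$), then for every vertex $v$ the distance of $b$ and $v$ is the same in $T_0$ and $T_1$.
   Context: The answer $q(x,y)$ to a queried pair is the distance of $x$ and $y$ in the hidden tree. A tree on $V$ is consistent if for every edge $xy$ of $Q$ its distance between $x$ and $y$ equals $q(x,y)$. -}

module Defs where

open import Data.Nat using (ℕ; zero; suc; _≤_; _∸_)
open import Data.Bool using (Bool; true; false; if_then_else_)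
open import Data.Fin using (Fin)
open import Data.List using (List; []; _∷_; map; allFin)
open import Data.Nat.ListAction using (sum)
open import Data.List.Relation.Unary.Unique.Propositional using (Unique)
open import Data.Product using (Σ; ∃; _×_; _,_)
open import Relation.Binary.PropositionalEquality using (_≡_)
open import Relation.Nullary using (¬_)

record SimpleGraph (n : ℕ) : Set where
  field
    adj    : Fin n → Fin n → Bool
    sym    : ∀ x y → adj x y ≡ adj y x
    irrefl : ∀ x → adj x x ≡ false
open SimpleGraph public

module _ {n : ℕ} (G : SimpleGraph n) where

  Edge : Fin n → Fin n → Set
  Edge x y = adj G x y ≡ true

  data Walk : Fin n → Fin n → Set where
    []  : ∀ {x} → Walk x x
    _∷_ : ∀ {x y z} → Edge x y → Walk y z → Walk x z

  wlength : ∀ {x y} → Walk x y → ℕ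
  wlength []      = 0
  wlength (_ ∷ w) = suc (wlength w)

  vertices : ∀ {x y} → Walk x y → List (Fin n)
  vertices {x} []      = x ∷ []
  vertices {x} (_ ∷ w) = x ∷ vertices w

  WalkOfLength : Fin n → Fin n → ℕ → Set
  WalkOfLength x y k = Σ (Walk x y) (λ w → wlength w ≡ k)

  Dist : Fin n → Fin n → ℕ → Set
  Dist x y d = WalkOfLength x y d × (∀ k → WalkOfLength x y k → d ≤ k)

  Connected : Set
  Connected = ∀ x y → ∃ λ k → WalkOfLength x y k

  HasCycle : Set
  HasCycle = Σ (Fin n) λ x → Σ (Fin n) λ y → Σ (Walk x y) λ w →
               (2 ≤ wlength w) × Unique (vertices w) × Edge y x

  Acyclic : Set
  Acyclic = ¬ HasCycle

  IsTree : Set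
  IsTree = Connected × Acyclic

  degree : Fin n → ℕ
  degree x = sum (map (λ y → if adj G x y then 1 else 0) (allFin n))

  MinDegreeAtLeast : ℕ → Set
  MinDegreeAtLeast m = ∀ x → m ≤ degree x

-- T is consistent with the answers to the queries Q about the hidden tree H:
-- for every edge xy of Q, dist_T(x,y) = q(x,y) = dist_H(x,y).
Consistent : {n : ℕ} → SimpleGraph n → SimpleGraph n → SimpleGraph n → Set
Consistent {n} Q H T = ∀ (x y : Fin n) → Edge Q x y →
  ∀ d e → Dist T x y d → Dist H x y e → d ≡ e

module Submission where

-- Call x y a disagreeing pair if its distances in T₀ and T₁ differ. Disagreeing
-- pairs are not queries, so by the degree condition every vertex lies in at most
-- two of them. Root both trees at d: since d disagrees with a (3 vs 1) and with
-- c (1 vs 3), it agrees with everything else, so depths below d coincide off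
-- {a, c}. Now show δ₁(b,v) ≤ δ₀(b,v) by induction on δ₀(b,v). If c agrees with
-- v, this follows from c hanging below b in T₁ and next to the root in T₀.
-- Otherwise b and c are the only vertices disagreeing with v, so the
-- T₀-neighbour p of v towards b agrees with v and induction applies. For
-- p ∈ {b, c} the T₁-parent of v must be b resp. a: any other vertex there would
-- agree with v and hence also be its T₀-parent p. Exchanging T₀ and T₁ (and a
-- and c) gives the reverse inequality.


open import Defs hiding (sym)
open import Data.Bool using (true; false; if_then_else_)
open import Data.Bool.Properties using () renaming (_≟_ to _≟ᵇ_)
open import Data.Empty using (⊥; ⊥-elim)
open import Data.Fin using (Fin; _≟_)
open import Data.Fin.Properties using (any?)
open import Data.List using (List; []; _∷_; _++_; map; length; allFin)
open import Data.List.Properties using (length-++; map-++; length-tabulate)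
open import Data.List.Membership.Propositional using (_∈_; _∉_)
open import Data.List.Membership.Propositional.Properties using (∈-∃++; ∈-allFin)
open import Data.List.Relation.Unary.Any using (here; there)
open import Data.List.Relation.Unary.All as All using (All; []; _∷_)
open import Data.List.Relation.Unary.All.Properties using (¬Any⇒All¬)
open import Data.List.Relation.Unary.AllPairs using ([]; _∷_)
open import Data.List.Relation.Unary.Unique.Propositional using (Unique)
open import Data.List.Relation.Binary.Subset.Propositional using (_⊆_)
open import Data.List.Relation.Binary.Permutation.Propositional using (_↭_; ↭-refl; ↭-trans; ↭-prep)
open import Data.List.Relation.Binary.Permutation.Propositional.Properties using (∈-resp-↭; shift; map⁺; ↭-length)
open import Data.Nat using (ℕ; zero; suc; _+_; _≤_; _<_; _∸_; z≤n; s≤s)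
  renaming (_≟_ to _≟ℕ_)
open import Data.Nat.Properties hiding (_≟_)
open import Data.Nat.Induction using (<-wellFounded)
open import Data.Nat.ListAction using (sum)
open import Data.Nat.ListAction.Properties using (sum-↭; sum-++)
open import Data.Product using (Σ; ∃; _×_; _,_; proj₁; proj₂)
open import Data.Sum using (_⊎_; inj₁; inj₂; [_,_]′)
open import Function using (_∘_; case_of_)
open import Induction.WellFounded using (module All)
open import Relation.Binary.Construct.On using (wellFounded)
open import Level using (0ℓ)
open import Relation.Nullary using (¬_; yes; no)
open import Relation.Nullary.Decidable using (_×-dec_)
open import Relation.Unary using (Decidable)
open import Relation.Binary.PropositionalEquality

LeastWitness : (ℕ → Set) → Set
LeastWitness P = Σ ℕ λ m → P m × (∀ {i} → P i → m ≤ i)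

module _ {P : ℕ → Set} (P? : Decidable P) where

  least-or-none : ∀ k → LeastWitness P ⊎ (∀ {i} → i ≤ k → ¬ P i)
  least-or-none zero with P? zero
  ... | yes p₀ = inj₁ (zero , p₀ , λ _ → z≤n)
  ... | no ¬p₀ = inj₂ λ { z≤n → ¬p₀ }
  least-or-none (suc k) with least-or-none k | P? (suc k)
  ... | inj₁ w    | _      = inj₁ w
  ... | inj₂ none | yes pₖ = inj₁ (suc k , pₖ , λ pᵢ → ≰⇒> λ i≤k → none i≤k pᵢ)
  ... | inj₂ none | no ¬pₖ = inj₂ λ i≤1+k →
    [ (λ i<1+k → none (≤-pred i<1+k)) , (λ { refl → ¬pₖ }) ]′ (m≤n⇒m<n∨m≡n i≤1+k)

  least : ∀ {k} → P k → LeastWitness P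
  least {k} pₖ with least-or-none k
  ... | inj₁ w    = w
  ... | inj₂ none = ⊥-elim (none ≤-refl pₖ)

module Walks {n : ℕ} (G : SimpleGraph n) where

  open import Data.List.Membership.DecPropositional (_≟_ {n}) using (_∈?_)

  Edge-sym : ∀ {x y} → Edge G x y → Edge G y x
  Edge-sym {x} {y} e = trans (SimpleGraph.sym G y x) e

  Edge⇒≢ : ∀ {x y} → Edge G x y → x ≢ y
  Edge⇒≢ {x} e refl with trans (sym e) (irrefl G x)
  ... | ()

  infixr 5 _++ʷ_

  _++ʷ_ : ∀ {x y z} → Walk G x y → Walk G y z → Walk G x z
  []      ++ʷ w′ = w′
  (e ∷ w) ++ʷ w′ = e ∷ (w ++ʷ w′)

  wlength-++ʷ : ∀ {x y z} (w : Walk G x y) (w′ : Walk G y z) →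
                wlength G (w ++ʷ w′) ≡ wlength G w + wlength G w′
  wlength-++ʷ []      w′ = refl
  wlength-++ʷ (e ∷ w) w′ = cong suc (wlength-++ʷ w w′)

  ∈-++ʷ⁻ : ∀ {x y z u} (w : Walk G x y) (w′ : Walk G y z) →
           u ∈ vertices G (w ++ʷ w′) → u ∈ vertices G w ⊎ u ∈ vertices G w′
  ∈-++ʷ⁻ []      w′ u∈         = inj₂ u∈
  ∈-++ʷ⁻ (e ∷ w) w′ (here u≡x) = inj₁ (here u≡x)
  ∈-++ʷ⁻ (e ∷ w) w′ (there u∈) = [ inj₁ ∘ there , inj₂ ]′ (∈-++ʷ⁻ w w′ u∈)

  reverseʷ : ∀ {x y} → Walk G x y → Walk G y x
  reverseʷ []      = []
  reverseʷ (e ∷ w) = reverseʷ w ++ʷ (Edge-sym e ∷ [])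

  wlength-reverseʷ : ∀ {x y} (w : Walk G x y) → wlength G (reverseʷ w) ≡ wlength G w
  wlength-reverseʷ []      = refl
  wlength-reverseʷ (e ∷ w) = begin
    wlength G (reverseʷ w ++ʷ (Edge-sym e ∷ [])) ≡⟨ wlength-++ʷ (reverseʷ w) _ ⟩
    wlength G (reverseʷ w) + 1                   ≡⟨ +-comm _ 1 ⟩
    suc (wlength G (reverseʷ w))                 ≡⟨ cong suc (wlength-reverseʷ w) ⟩
    suc (wlength G w)                            ∎
    where open ≡-Reasoning

  ≢⇒1≤wlength : ∀ {x y} (w : Walk G x y) → x ≢ y → 1 ≤ wlength G w
  ≢⇒1≤wlength []      x≢x = ⊥-elim (x≢x refl)
  ≢⇒1≤wlength (_ ∷ _) _   = s≤s z≤n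

  split-at : ∀ {x y u} (w : Walk G x y) → u ∈ vertices G w →
             Σ (Walk G x u) λ w₁ → Σ (Walk G u y) λ w₂ →
               wlength G w₁ + wlength G w₂ ≡ wlength G w
  split-at []      (here refl) = [] , [] , refl
  split-at (e ∷ w) (here refl) = [] , e ∷ w , refl
  split-at (e ∷ w) (there u∈) with split-at w u∈
  ... | w₁ , w₂ , len = e ∷ w₁ , w₂ , cong suc len

  suffix-from : ∀ {x y u} (w : Walk G x y) → u ∈ vertices G w →
                Σ (Walk G u y) λ w′ →
                  vertices G w′ ⊆ vertices G w × (Unique (vertices G w) → Unique (vertices G w′))
  suffix-from []      (here refl) = [] , (λ u∈ → u∈) , (λ uniq → uniq)
  suffix-from (e ∷ w) (here refl) = e ∷ w , (λ u∈ → u∈) , (λ uniq → uniq)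
  suffix-from (e ∷ w) (there u∈) with suffix-from w u∈
  ... | w′ , w′⊆w , unique′ = w′ , there ∘ w′⊆w , λ { (_ ∷ uniq) → unique′ uniq }

  erase-loops : ∀ {x y} (w : Walk G x y) →
           Σ (Walk G x y) λ p → Unique (vertices G p) × vertices G p ⊆ vertices G w
  erase-loops [] = [] , [] ∷ [] , (λ u∈ → u∈)
  erase-loops {x} (e ∷ w) with erase-loops w
  ... | p , p-unique , p⊆w with x ∈? vertices G p
  ...   | yes x∈p = let (p′ , p′⊆p , unique′) = suffix-from p x∈p in
                    p′ , unique′ p-unique , there ∘ p⊆w ∘ p′⊆p
  ...   | no x∉p  = e ∷ p , ¬Any⇒All¬ _ x∉p ∷ p-unique ,
                    λ { (here u≡x) → here u≡x ; (there u∈) → there (p⊆w u∈) }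

  walkOfLength? : ∀ x y → Decidable (WalkOfLength G x y)
  walkOfLength? x y zero with x ≟ y
  ... | yes refl = yes ([] , refl)
  ... | no x≢y   = no λ { ([] , _) → x≢y refl ; ((_ ∷ _) , ()) }
  walkOfLength? x y (suc k) with any? (λ z → (adj G x z ≟ᵇ true) ×-dec walkOfLength? z y k)
  ... | yes (z , e , w , len) = yes (e ∷ w , cong suc len)
  ... | no ¬step = no λ { ([] , ()) ; ((e ∷ w) , len) → ¬step (_ , e , w , suc-injective len) }

  module Distance (connected : Connected G) where

    private
      shortest : ∀ x y → LeastWitness (WalkOfLength G x y)
      shortest x y = least (walkOfLength? x y) (proj₂ (connected x y))

    dist : Fin n → Fin n → ℕ
    dist x y = proj₁ (shortest x y)

    geodesic : ∀ x y → WalkOfLength G x y (dist x y)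
    geodesic x y = proj₁ (proj₂ (shortest x y))

    dist-minimal : ∀ {x y} (w : Walk G x y) → dist x y ≤ wlength G w
    dist-minimal {x} {y} w = proj₂ (proj₂ (shortest x y)) (w , refl)

    Dist-dist : ∀ x y → Dist G x y (dist x y)
    Dist-dist x y = geodesic x y , λ _ → proj₂ (proj₂ (shortest x y))

    Dist⇒≡dist : ∀ {x y k} → Dist G x y k → k ≡ dist x y
    Dist⇒≡dist {x} {y} (w , k-minimal) =
      ≤-antisym (k-minimal _ (geodesic x y)) (proj₂ (proj₂ (shortest x y)) w)

    dist-refl : ∀ x → dist x x ≡ 0
    dist-refl x = n≤0⇒n≡0 (dist-minimal {x} [])

    dist≡0⇒≡ : ∀ {x y} → dist x y ≡ 0 → x ≡ y
    dist≡0⇒≡ {x} {y} x-y≡0 with geodesic x y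
    ... | []      , _   = refl
    ... | (_ ∷ _) , len = ⊥-elim (1+n≢0 (trans len x-y≡0))

    dist-edge : ∀ {x y} → Edge G x y → dist x y ≡ 1
    dist-edge e = ≤-antisym (dist-minimal (e ∷ [])) (n≢0⇒n>0 (Edge⇒≢ e ∘ dist≡0⇒≡))

    dist≡1⇒Edge : ∀ {x y} → dist x y ≡ 1 → Edge G x y
    dist≡1⇒Edge {x} {y} x-y≡1 with geodesic x y
    ... | []           , len = ⊥-elim (0≢1+n (trans len x-y≡1))
    ... | (e ∷ [])     , _   = e
    ... | (_ ∷ _ ∷ _)  , len = case trans len x-y≡1 of λ ()

    dist-triangle : ∀ x y z → dist x z ≤ dist x y + dist y z
    dist-triangle x y z with geodesic x y | geodesic y z
    ... | w , x-y | w′ , y-z = begin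
      dist x z                      ≤⟨ dist-minimal (w ++ʷ w′) ⟩
      wlength G (w ++ʷ w′)          ≡⟨ wlength-++ʷ w w′ ⟩
      wlength G w + wlength G w′    ≡⟨ cong₂ _+_ x-y y-z ⟩
      dist x y + dist y z           ∎
      where open ≤-Reasoning

    dist-sym : ∀ x y → dist x y ≡ dist y x
    dist-sym x y = ≤-antisym (≤-flip x y) (≤-flip y x)
      where
        ≤-flip : ∀ x y → dist x y ≤ dist y x
        ≤-flip x y with geodesic y x
        ... | w , y-x =
          subst (dist x y ≤_) (trans (wlength-reverseʷ w) y-x) (dist-minimal (reverseʷ w))

    dist-via-edgeˡ : ∀ {x y z} → Edge G x y → dist x z ≤ suc (dist y z)
    dist-via-edgeˡ {x} {y} {z} e =
      subst (dist x z ≤_) (cong (_+ dist y z) (dist-edge e)) (dist-triangle x y z)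

    dist-via-edgeʳ : ∀ {x y z} → Edge G y z → dist x z ≤ suc (dist x y)
    dist-via-edgeʳ {x} {y} {z} e =
      subst (dist x z ≤_) (trans (cong (dist x y +_) (dist-edge e)) (+-comm _ 1)) (dist-triangle x y z)

    dist-step : ∀ {x y j} → dist x y ≡ suc j → ∃ λ z → Edge G x z × dist z y ≡ j
    dist-step {x} {y} {j} x-y≡1+j with geodesic x y
    ... | [] , len = ⊥-elim (0≢1+n (trans len x-y≡1+j))
    ... | (_∷_ {y = z} e w) , len = z , e , ≤-antisym z-y≤j j≤z-y
      where
        z-y≤j : dist z y ≤ j
        z-y≤j = ≤-trans (dist-minimal w) (≤-reflexive (suc-injective (trans len x-y≡1+j)))
        j≤z-y : j ≤ dist z y
        j≤z-y = ≤-pred (subst (_≤ suc (dist z y)) x-y≡1+j (dist-via-edgeˡ e))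

    parent : ∀ {r v j} → dist r v ≡ suc j → ∃ λ p → Edge G v p × dist r p ≡ j
    parent {r} {v} r-v≡1+j with dist-step (trans (dist-sym v r) r-v≡1+j)
    ... | p , e , p-r≡j = p , e , trans (dist-sym r p) p-r≡j

    on-geodesic : ∀ {x y u} (w : Walk G x y) → wlength G w ≡ dist x y →
                  u ∈ vertices G w → dist x u + dist u y ≤ dist x y
    on-geodesic w geo u∈ with split-at w u∈
    ... | w₁ , w₂ , len =
      ≤-trans (+-mono-≤ (dist-minimal w₁) (dist-minimal w₂)) (≤-reflexive (trans len geo))

    module Tree (acyclic : Acyclic G) where

      -- Two such neighbours z₁ ≢ z₂ would close a cycle through y: the
      -- geodesics z₁ → r → z₂ avoid y, and loop erasure turns them into a path.
      closer-neighbour-unique : ∀ {r y z₁ z₂} → Edge G y z₁ → Edge G y z₂ →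
                                dist r z₁ ≤ dist r y → dist r z₂ ≤ dist r y → z₁ ≡ z₂
      closer-neighbour-unique {r} {y} {z₁} {z₂} e₁ e₂ z₁≤y z₂≤y with z₁ ≟ z₂
      ... | yes z₁≡z₂ = z₁≡z₂
      ... | no z₁≢z₂  = ⊥-elim (acyclic (y , z₂ , e₁ ∷ p , s≤s (≢⇒1≤wlength p z₁≢z₂) ,
                                         ¬Any⇒All¬ _ (y∉w ∘ p⊆w) ∷ p-unique , Edge-sym e₂))
        where
          g₁ = geodesic z₁ r
          g₂ = geodesic r z₂
          w = proj₁ g₁ ++ʷ proj₁ g₂
          p = proj₁ (erase-loops w)
          p-unique = proj₁ (proj₂ (erase-loops w))
          p⊆w = proj₂ (proj₂ (erase-loops w))

          y∉w : y ∉ vertices G w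
          y∉w y∈w with ∈-++ʷ⁻ (proj₁ g₁) (proj₁ g₂) y∈w
          ... | inj₁ y∈g₁ = 1+n≰n (begin
                  1 + dist y r          ≡⟨ cong (_+ dist y r) (sym (dist-edge (Edge-sym e₁))) ⟩
                  dist z₁ y + dist y r  ≤⟨ on-geodesic (proj₁ g₁) (proj₂ g₁) y∈g₁ ⟩
                  dist z₁ r             ≡⟨ dist-sym z₁ r ⟩
                  dist r z₁             ≤⟨ z₁≤y ⟩
                  dist r y              ≡⟨ dist-sym r y ⟩
                  dist y r              ∎)
            where open ≤-Reasoning
          ... | inj₂ y∈g₂ = 1+n≰n (begin
                  suc (dist r y)        ≡⟨ +-comm 1 (dist r y) ⟩
                  dist r y + 1          ≡⟨ cong (dist r y +_) (sym (dist-edge e₂)) ⟩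
                  dist r y + dist y z₂  ≤⟨ on-geodesic (proj₁ g₂) (proj₂ g₂) y∈g₂ ⟩
                  dist r z₂             ≤⟨ z₂≤y ⟩
                  dist r y              ∎)
            where open ≤-Reasoning

      farther-neighbour : ∀ {r y z₁ z₂} → Edge G y z₁ → Edge G y z₂ → z₁ ≢ z₂ →
                          dist r z₁ ≤ dist r y → dist r z₂ ≡ suc (dist r y)
      farther-neighbour e₁ e₂ z₁≢z₂ z₁≤y =
        ≤-antisym (dist-via-edgeʳ e₂)
                  (≰⇒> λ z₂≤y → z₁≢z₂ (closer-neighbour-unique e₁ e₂ z₁≤y z₂≤y))

      path₃-dist : ∀ {r x y z} → Edge G r x → Edge G x y → Edge G y z → r ≢ y → x ≢ z →
                   dist r x ≡ 1 × dist r y ≡ 2 × dist r z ≡ 3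
      path₃-dist {r} e₁ e₂ e₃ r≢y x≢z = r-x , r-y , r-z
        where
          r-x = dist-edge e₁
          r-y = trans (farther-neighbour (Edge-sym e₁) e₂ r≢y
                         (subst₂ _≤_ (sym (dist-refl r)) (sym r-x) z≤n)) (cong suc r-x)
          r-z = trans (farther-neighbour (Edge-sym e₂) e₃ x≢z
                         (subst₂ _≤_ (sym r-x) (sym r-y) (n≤1+n 1))) (cong suc r-y)

      through-parent⊎descendant : ∀ {r x p} → Edge G x p → dist r p ≤ dist r x → ∀ v →
                                  dist p v < dist x v ⊎ dist r v ≡ dist r x + dist x v
      through-parent⊎descendant {r} {x} e p≤x v = go (dist x v) refl e p≤x
        where
          go : ∀ k {x p} → dist x v ≡ k → Edge G x p → dist r p ≤ dist r x →
               dist p v < dist x v ⊎ dist r v ≡ dist r x + dist x v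
          go zero {x} x-v≡0 _ _ with dist≡0⇒≡ x-v≡0
          ... | refl = inj₂ (sym (trans (cong (dist r x +_) x-v≡0) (+-identityʳ _)))
          go (suc j) {x} {p} x-v≡1+j e p≤x with dist-step x-v≡1+j
          ... | y , e′ , y-v≡j with y ≟ p
          ...   | yes refl = inj₁ (subst₂ _<_ (sym y-v≡j) (sym x-v≡1+j) ≤-refl)
          ...   | no y≢p with farther-neighbour e e′ (y≢p ∘ sym) p≤x
          ...     | r-y≡ with go j y-v≡j (Edge-sym e′) (subst (dist r x ≤_) (sym r-y≡) (n≤1+n _))
          ...       | inj₁ x-v<y-v = ⊥-elim (<-asym x-v<y-v (subst₂ _<_ (sym y-v≡j) (sym x-v≡1+j) ≤-refl))
          ...       | inj₂ r-v≡ = inj₂ (begin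
                        dist r v              ≡⟨ r-v≡ ⟩
                        dist r y + dist y v   ≡⟨ cong₂ _+_ r-y≡ y-v≡j ⟩
                        suc (dist r x) + j    ≡⟨ sym (+-suc (dist r x) j) ⟩
                        dist r x + suc j      ≡⟨ cong (dist r x +_) (sym x-v≡1+j) ⟩
                        dist r x + dist x v   ∎)
            where open ≡-Reasoning

module _ {A : Set} where

  extract : ∀ {z : A} {xs} → z ∈ xs → ∃ λ ys → xs ↭ z ∷ ys
  extract {z} z∈xs with ys , ys′ , refl ← ∈-∃++ z∈xs = ys ++ ys′ , shift z ys ys′

  ∈-↭∷⁻ : ∀ {z u : A} {xs ys} → xs ↭ z ∷ ys → z ≢ u → u ∈ xs → u ∈ ys
  ∈-↭∷⁻ xs↭z∷ys z≢u u∈xs with ∈-resp-↭ xs↭z∷ys u∈xs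
  ... | here u≡z   = ⊥-elim (z≢u (sym u≡z))
  ... | there u∈ys = u∈ys

  Unique-⊆⇒↭++ : ∀ {zs xs : List A} → Unique zs → All (_∈ xs) zs → ∃ λ rest → xs ↭ zs ++ rest
  Unique-⊆⇒↭++ {[]}     {xs} _ _ = xs , ↭-refl
  Unique-⊆⇒↭++ {z ∷ zs} (z∉zs ∷ zs-unique) (z∈xs ∷ zs⊆xs)
    with ys , xs↭z∷ys ← extract z∈xs
    with rest , ys↭zs++rest ← Unique-⊆⇒↭++ zs-unique
           (All.zipWith (λ (z≢u , u∈xs) → ∈-↭∷⁻ xs↭z∷ys z≢u u∈xs) (z∉zs , zs⊆xs))
    = rest , ↭-trans xs↭z∷ys (↭-prep z ys↭zs++rest)

module _ {n : ℕ} (G : SimpleGraph n) (x : Fin n) where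

  private
    indicator : Fin n → ℕ
    indicator y = if adj G x y then 1 else 0

    sum-indicator≤length : ∀ ys → sum (map indicator ys) ≤ length ys
    sum-indicator≤length []       = z≤n
    sum-indicator≤length (y ∷ ys) = +-mono-≤ (bounded (adj G x y)) (sum-indicator≤length ys)
      where
        bounded : ∀ b → (if b then 1 else 0) ≤ 1
        bounded true  = ≤-refl
        bounded false = z≤n

    sum-indicator≡0 : ∀ {ys} → All (λ y → ¬ Edge G x y) ys → sum (map indicator ys) ≡ 0
    sum-indicator≡0 []                   = refl
    sum-indicator≡0 {y ∷ _} (¬e ∷ ¬es) with adj G x y | ¬e
    ... | true  | ¬e′ = ⊥-elim (¬e′ refl)
    ... | false | _   = sum-indicator≡0 ¬es

  non-neighbours+degree≤n : ∀ {zs} → Unique zs → All (λ y → ¬ Edge G x y) zs →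
                            length zs + degree G x ≤ n
  non-neighbours+degree≤n {zs} zs-unique non-adjacent
    with rest , allFin↭ ← Unique-⊆⇒↭++ zs-unique (All.tabulate λ {y} _ → ∈-allFin y) = begin
      length zs + degree G x
        ≡⟨ cong (length zs +_) (sum-↭ (map⁺ indicator allFin↭)) ⟩
      length zs + sum (map indicator (zs ++ rest))
        ≡⟨ cong (λ s → length zs + sum s) (map-++ indicator zs rest) ⟩
      length zs + sum (map indicator zs ++ map indicator rest)
        ≡⟨ cong (length zs +_) (sum-++ (map indicator zs) _) ⟩
      length zs + (sum (map indicator zs) + sum (map indicator rest))
        ≡⟨ cong (λ s → length zs + (s + _)) (sum-indicator≡0 non-adjacent) ⟩
      length zs + sum (map indicator rest)
        ≤⟨ +-monoʳ-≤ (length zs) (sum-indicator≤length rest) ⟩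
      length zs + length rest
        ≡⟨ sym (length-++ zs) ⟩
      length (zs ++ rest)
        ≡⟨ sym (↭-length allFin↭) ⟩
      length (allFin n)
        ≡⟨ length-tabulate _ ⟩
      n ∎
    where open ≤-Reasoning

  at-most-two-non-neighbours : 3 ≤ n → MinDegreeAtLeast G (n ∸ 3) →
    ∀ {y₁ y₂ y₃} → Unique (x ∷ y₁ ∷ y₂ ∷ y₃ ∷ []) →
    ¬ Edge G x y₁ → ¬ Edge G x y₂ → ¬ Edge G x y₃ → ⊥
  at-most-two-non-neighbours 3≤n min-degree uniq ¬e₁ ¬e₂ ¬e₃ = 1+n≰n (begin
    suc n              ≡⟨ cong suc (sym (m+[n∸m]≡n 3≤n)) ⟩
    4 + (n ∸ 3)        ≤⟨ +-monoʳ-≤ 4 (min-degree x) ⟩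
    4 + degree G x     ≤⟨ non-neighbours+degree≤n uniq (x≁x ∷ ¬e₁ ∷ ¬e₂ ∷ ¬e₃ ∷ []) ⟩
    n                  ∎)
    where
      open ≤-Reasoning
      x≁x : ¬ Edge G x x
      x≁x e = Walks.Edge⇒≢ G e refl

module TwoTrees {n : ℕ} (T₀ T₁ : SimpleGraph n) (tree₀ : IsTree T₀) (tree₁ : IsTree T₁) where

  open Walks T₀ using () renaming (Edge-sym to Edge₀-sym)
  open Walks T₁ using () renaming (Edge-sym to Edge₁-sym)
  module D₀ = Walks.Distance T₀ (proj₁ tree₀)
  module D₁ = Walks.Distance T₁ (proj₁ tree₁)
  module R₀ = D₀.Tree (proj₂ tree₀)
  module R₁ = D₁.Tree (proj₂ tree₁)

  δ₀ δ₁ : Fin n → Fin n → ℕ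
  δ₀ = D₀.dist
  δ₁ = D₁.dist

  Agree : Fin n → Fin n → Set
  Agree x y = δ₀ x y ≡ δ₁ x y

  Agree-refl : ∀ x → Agree x x
  Agree-refl x = trans (D₀.dist-refl x) (sym (D₁.dist-refl x))

  Agree-sym : ∀ {x y} → Agree x y → Agree y x
  Agree-sym {x} {y} eq = trans (D₀.dist-sym y x) (trans eq (D₁.dist-sym x y))

  Agree-by-values : ∀ {x y i} → δ₀ x y ≡ i → δ₁ x y ≡ i → Agree x y
  Agree-by-values p q = trans p (sym q)

  Disagree-by-values : ∀ {x y i j} → δ₀ x y ≡ i → δ₁ x y ≡ j → i ≢ j → ¬ Agree x y
  Disagree-by-values p q i≢j eq = i≢j (trans (sym p) (trans eq q))

  AtMostTwoDisagreements : Set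
  AtMostTwoDisagreements = ∀ {v y₁ y₂ x} → y₁ ≢ y₂ → x ≢ y₁ → x ≢ y₂ →
                           ¬ Agree y₁ v → ¬ Agree y₂ v → Agree x v

  module Configuration (agree-third : AtMostTwoDisagreements) {a b c d : Fin n}
    (a≢c : a ≢ c) (b≢d : b ≢ d)
    (e₀ab : Edge T₀ a b) (e₀bc : Edge T₀ b c) (e₀cd : Edge T₀ c d)
    (e₁da : Edge T₁ d a) (e₁ab : Edge T₁ a b) (e₁bc : Edge T₁ b c) where

    private
      depths₀ : δ₀ d c ≡ 1 × δ₀ d b ≡ 2 × δ₀ d a ≡ 3
      depths₀ = R₀.path₃-dist (Edge₀-sym e₀cd) (Edge₀-sym e₀bc) (Edge₀-sym e₀ab) (b≢d ∘ sym) (a≢c ∘ sym)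

      depths₁ : δ₁ d a ≡ 1 × δ₁ d b ≡ 2 × δ₁ d c ≡ 3
      depths₁ = R₁.path₃-dist e₁da e₁ab e₁bc (b≢d ∘ sym) a≢c

    δ₀dc : δ₀ d c ≡ 1
    δ₀dc = proj₁ depths₀
    δ₀db : δ₀ d b ≡ 2
    δ₀db = proj₁ (proj₂ depths₀)
    δ₀da : δ₀ d a ≡ 3
    δ₀da = proj₂ (proj₂ depths₀)
    δ₁da : δ₁ d a ≡ 1
    δ₁da = proj₁ depths₁
    δ₁db : δ₁ d b ≡ 2
    δ₁db = proj₁ (proj₂ depths₁)
    δ₁dc : δ₁ d c ≡ 3
    δ₁dc = proj₂ (proj₂ depths₁)

    Agree-d : ∀ {v} → v ≢ a → v ≢ c → Agree d v
    Agree-d v≢a v≢c = Agree-sym (agree-third a≢c v≢a v≢c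
      (Disagree-by-values δ₀da δ₁da (λ ()) ∘ Agree-sym) (Disagree-by-values δ₀dc δ₁dc (λ ()) ∘ Agree-sym))

    Agree-b-a : Agree b a
    Agree-b-a = Agree-by-values (D₀.dist-edge (Edge₀-sym e₀ab)) (D₁.dist-edge (Edge₁-sym e₁ab))

    Agree-b-c : Agree b c
    Agree-b-c = Agree-by-values (D₀.dist-edge e₀bc) (D₁.dist-edge e₁bc)

    Agree-b-d : Agree b d
    Agree-b-d = Agree-sym (Agree-by-values δ₀db δ₁db)

    private
      ≤-via : ∀ {m n i j} → m ≡ i → n ≡ j → i ≤ j → m ≤ n
      ≤-via refl refl i≤j = i≤j

      ≢-by-depth₁ : ∀ {x y i j} → δ₁ d x ≡ i → δ₁ d y ≡ j → i ≢ j → x ≢ y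
      ≢-by-depth₁ p q i≢j refl = i≢j (trans (sym p) q)

      disagreeing⇒≢ : ∀ {v x} → ¬ Agree b v → Agree b x → v ≢ x
      disagreeing⇒≢ ¬b-v b-x refl = ¬b-v b-x

    -- Were v below c in T₁, it would be at depth 3 + δ₀ c v there, but
    -- at depth at most 1 + δ₀ c v in T₀, where c is adjacent to the root d.
    δ₁b≤δ₀b-if-c-agrees : ∀ {v} → v ≢ a → v ≢ c → Agree c v → δ₁ b v ≤ δ₀ b v
    δ₁b≤δ₀b-if-c-agrees {v} v≢a v≢c c-v
      with R₁.through-parent⊎descendant (Edge₁-sym e₁bc) (≤-via δ₁db δ₁dc (n≤1+n 2)) v
    ... | inj₁ b-v<c-v = ≤-pred (begin-strict
            δ₁ b v        <⟨ b-v<c-v ⟩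
            δ₁ c v        ≡⟨ sym c-v ⟩
            δ₀ c v        ≤⟨ D₀.dist-via-edgeˡ (Edge₀-sym e₀bc) ⟩
            suc (δ₀ b v)  ∎)
      where open ≤-Reasoning
    ... | inj₂ d-v≡ = case +-cancelʳ-≤ (suc (δ₀ c v)) 2 0 (begin
            3 + δ₀ c v       ≡⟨ cong₂ _+_ (sym δ₁dc) c-v ⟩
            δ₁ d c + δ₁ c v  ≡⟨ sym d-v≡ ⟩
            δ₁ d v           ≡⟨ sym (Agree-d v≢a v≢c) ⟩
            δ₀ d v           ≤⟨ D₀.dist-via-edgeˡ (Edge₀-sym e₀cd) ⟩
            suc (δ₀ c v)     ∎) of λ ()
      where open ≤-Reasoning

    T₁-parent≡T₀-parent : ∀ {v x y} → v ≢ a → v ≢ c → x ≢ a → x ≢ c → Agree x v →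
                          Edge T₁ v x → δ₁ d x ≤ δ₁ d v → Edge T₀ v y → δ₀ d y ≤ δ₀ d v → y ≡ x
    T₁-parent≡T₀-parent {v} {x} v≢a v≢c x≢a x≢c x-v e₁vx x≤v e₀vy y≤v =
      R₀.closer-neighbour-unique e₀vy e₀vx y≤v (begin
        δ₀ d x  ≡⟨ Agree-d x≢a x≢c ⟩
        δ₁ d x  ≤⟨ x≤v ⟩
        δ₁ d v  ≡⟨ sym (Agree-d v≢a v≢c) ⟩
        δ₀ d v  ∎)
      where
        open ≤-Reasoning
        e₀vx : Edge T₀ v x
        e₀vx = Edge₀-sym (D₀.dist≡1⇒Edge (trans x-v (D₁.dist-edge (Edge₁-sym e₁vx))))

    OnlyBCDisagreeWith : Fin n → Set
    OnlyBCDisagreeWith v = ∀ {x} → x ≢ b → x ≢ c → Agree x v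

    δ₁b≤1-if-T₀-adjacent-to-b : ∀ {v} → v ≢ a → v ≢ c → OnlyBCDisagreeWith v →
                                Edge T₀ v b → δ₁ b v ≤ 1
    δ₁b≤1-if-T₀-adjacent-to-b {v} v≢a v≢c agree e₀vb = via-T₁-parent (D₁.parent δ₁dv≡3)
      where
        δ₁dv≡3 : δ₁ d v ≡ 3
        δ₁dv≡3 = trans (sym (Agree-d v≢a v≢c))
          (trans (R₀.farther-neighbour e₀bc (Edge₀-sym e₀vb) (v≢c ∘ sym) (≤-via δ₀dc δ₀db (n≤1+n 1)))
                 (cong suc δ₀db))

        via-T₁-parent : (∃ λ x → Edge T₁ v x × δ₁ d x ≡ 2) → δ₁ b v ≤ 1
        via-T₁-parent (x , e₁vx , δ₁dx≡2) with x ≟ b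
        ... | yes refl = ≤-reflexive (D₁.dist-edge (Edge₁-sym e₁vx))
        ... | no x≢b   = ⊥-elim (x≢b (sym (T₁-parent≡T₀-parent v≢a v≢c x≢a x≢c (agree x≢b x≢c)
                            e₁vx (≤-via δ₁dx≡2 δ₁dv≡3 (n≤1+n 2))
                            e₀vb (≤-via δ₀db (trans (Agree-d v≢a v≢c) δ₁dv≡3) (n≤1+n 2)))))
          where
            x≢a = ≢-by-depth₁ δ₁dx≡2 δ₁da (λ ())
            x≢c = ≢-by-depth₁ δ₁dx≡2 δ₁dc (λ ())

    δ₁b≤2-if-T₀-adjacent-to-c : ∀ {v} → v ≢ a → v ≢ d → OnlyBCDisagreeWith v →
                                Edge T₀ v c → δ₁ b v ≤ 2
    δ₁b≤2-if-T₀-adjacent-to-c {v} v≢a v≢d agree e₀vc = via-T₁-parent (D₁.parent δ₁dv≡2)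
      where
        v≢c = Walks.Edge⇒≢ T₀ e₀vc
        δ₀dv≡2 : δ₀ d v ≡ 2
        δ₀dv≡2 = trans (R₀.farther-neighbour e₀cd (Edge₀-sym e₀vc) (v≢d ∘ sym)
                                             (≤-via (D₀.dist-refl d) δ₀dc z≤n))
                       (cong suc δ₀dc)
        δ₁dv≡2 : δ₁ d v ≡ 2
        δ₁dv≡2 = trans (sym (Agree-d v≢a v≢c)) δ₀dv≡2

        via-T₁-parent : (∃ λ x → Edge T₁ v x × δ₁ d x ≡ 1) → δ₁ b v ≤ 2
        via-T₁-parent (x , e₁vx , δ₁dx≡1) with x ≟ a
        ... | yes refl = ≤-via refl (cong suc (sym (D₁.dist-edge (Edge₁-sym e₁ab))))
                                    (D₁.dist-via-edgeʳ (Edge₁-sym e₁vx))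
        ... | no x≢a   = ⊥-elim (x≢c (sym (T₁-parent≡T₀-parent v≢a v≢c x≢a x≢c (agree x≢b x≢c)
                            e₁vx (≤-via δ₁dx≡1 δ₁dv≡2 (n≤1+n 1)) e₀vc (≤-via δ₀dc δ₀dv≡2 (n≤1+n 1)))))
          where
            x≢b = ≢-by-depth₁ δ₁dx≡1 δ₁db (λ ())
            x≢c = ≢-by-depth₁ δ₁dx≡1 δ₁dc (λ ())

    δ₁b≤δ₀b-if-only-b-c-disagree : ∀ {v} → v ≢ a → v ≢ b → v ≢ c → v ≢ d → OnlyBCDisagreeWith v →
                                   (∀ {u} → δ₀ b u < δ₀ b v → δ₁ b u ≤ δ₀ b u) → δ₁ b v ≤ δ₀ b v
    δ₁b≤δ₀b-if-only-b-c-disagree {v} v≢a v≢b v≢c v≢d agree ih with δ₀ b v in b-v≡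
    ... | zero  = ⊥-elim (v≢b (sym (D₀.dist≡0⇒≡ b-v≡)))
    ... | suc j with D₀.parent b-v≡
    ...   | p , e₀vp , b-p≡j with p ≟ b | p ≟ c
    ...     | yes refl | _        = ≤-trans (δ₁b≤1-if-T₀-adjacent-to-b v≢a v≢c agree e₀vp) (s≤s z≤n)
    ...     | no _     | yes refl = ≤-trans (δ₁b≤2-if-T₀-adjacent-to-c v≢a v≢d agree e₀vp)
                                      (s≤s (≤-reflexive (trans (sym (D₀.dist-edge e₀bc)) b-p≡j)))
    ...     | no p≢b   | no p≢c   = begin
              δ₁ b v        ≤⟨ D₁.dist-via-edgeʳ e₁pv ⟩
              suc (δ₁ b p)  ≤⟨ s≤s (ih (≤-reflexive (cong suc b-p≡j))) ⟩
              suc (δ₀ b p)  ≡⟨ cong suc b-p≡j ⟩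
              suc j         ∎
      where
        open ≤-Reasoning
        e₁pv : Edge T₁ p v
        e₁pv = D₁.dist≡1⇒Edge (trans (sym (agree p≢b p≢c)) (D₀.dist-edge (Edge₀-sym e₀vp)))

    δ₁b≤δ₀b : ∀ v → δ₁ b v ≤ δ₀ b v
    δ₁b≤δ₀b = All.wfRec (wellFounded (δ₀ b) <-wellFounded) 0ℓ (λ v → δ₁ b v ≤ δ₀ b v) step
      where
        step : ∀ v → (∀ {u} → δ₀ b u < δ₀ b v → δ₁ b u ≤ δ₀ b u) → δ₁ b v ≤ δ₀ b v
        step v ih with δ₀ b v ≟ℕ δ₁ b v | δ₀ c v ≟ℕ δ₁ c v
        ... | yes b-v | _       = ≤-reflexive (sym b-v)
        ... | no ¬b-v | yes c-v =
              δ₁b≤δ₀b-if-c-agrees (disagreeing⇒≢ ¬b-v Agree-b-a) (disagreeing⇒≢ ¬b-v Agree-b-c) c-v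
        ... | no ¬b-v | no ¬c-v = δ₁b≤δ₀b-if-only-b-c-disagree
              (disagreeing⇒≢ ¬b-v Agree-b-a) (disagreeing⇒≢ ¬b-v (Agree-refl b)) (disagreeing⇒≢ ¬b-v Agree-b-c)
              (disagreeing⇒≢ ¬b-v Agree-b-d) (λ x≢b x≢c → agree-third (Walks.Edge⇒≢ T₀ e₀bc) x≢b x≢c ¬b-v ¬c-v) ih

module Queries {n : ℕ} (Q H : SimpleGraph n) (3≤n : 3 ≤ n) (min-degree : MinDegreeAtLeast Q (n ∸ 3))
  (H-connected : Connected H) {T₀ T₁ : SimpleGraph n} (tree₀ : IsTree T₀) (tree₁ : IsTree T₁)
  (consistent₀ : Consistent Q H T₀) (consistent₁ : Consistent Q H T₁) where

  open TwoTrees T₀ T₁ tree₀ tree₁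
  module Dᴴ = Walks.Distance H H-connected

  Agree-on-queries : ∀ {x y} → Edge Q x y → Agree x y
  Agree-on-queries {x} {y} e =
    trans (consistent₀ x y e _ _ (D₀.Dist-dist x y) (Dᴴ.Dist-dist x y))
          (sym (consistent₁ x y e _ _ (D₁.Dist-dist x y) (Dᴴ.Dist-dist x y)))

  at-most-two-disagreements : AtMostTwoDisagreements
  at-most-two-disagreements {v} {y₁} {y₂} {x} y₁≢y₂ x≢y₁ x≢y₂ ¬y₁-v ¬y₂-v with δ₀ x v ≟ℕ δ₁ x v
  ... | yes x-v = x-v
  ... | no ¬x-v = ⊥-elim (at-most-two-non-neighbours Q v 3≤n min-degree
          ((≢v ¬y₁-v ∘ sym ∷ ≢v ¬y₂-v ∘ sym ∷ ≢v ¬x-v ∘ sym ∷ []) ∷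
           (y₁≢y₂ ∷ x≢y₁ ∘ sym ∷ []) ∷ (x≢y₂ ∘ sym ∷ []) ∷ [] ∷ [])
          (non-query ¬y₁-v) (non-query ¬y₂-v) (non-query ¬x-v))
    where
      ≢v : ∀ {y} → ¬ Agree y v → y ≢ v
      ≢v ¬y-v refl = ¬y-v (Agree-refl v)
      non-query : ∀ {y} → ¬ Agree y v → ¬ Edge Q v y
      non-query ¬y-v = ¬y-v ∘ Agree-sym ∘ Agree-on-queries

lemma2p10 : (n : ℕ) → 13 ≤ n →
    (Q H T₀ T₁ : SimpleGraph n) →
    MinDegreeAtLeast Q (n ∸ 3) →
    IsTree H → IsTree T₀ → IsTree T₁ →
    Consistent Q H T₀ → Consistent Q H T₁ →
    (a b c d : Fin n) →
    a ≢ b → a ≢ c → a ≢ d → b ≢ c → b ≢ d → c ≢ d →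
    Edge T₀ a b → Edge T₀ b c → Edge T₀ c d →
    Edge T₁ d a → Edge T₁ a b → Edge T₁ b c →
    ∀ (v : Fin n) (k₀ k₁ : ℕ) → Dist T₀ b v k₀ → Dist T₁ b v k₁ → k₀ ≡ k₁
lemma2p10 n 13≤n Q H T₀ T₁ min-degree (H-connected , _) tree₀ tree₁ consistent₀ consistent₁
  a b c d _ a≢c _ _ b≢d _ e₀ab e₀bc e₀cd e₁da e₁ab e₁bc v k₀ k₁ dist₀ dist₁ = begin
    k₀        ≡⟨ D₀.Dist⇒≡dist dist₀ ⟩
    δ₀ b v    ≡⟨ ≤-antisym δ₀≤δ₁ δ₁≤δ₀ ⟩
    δ₁ b v    ≡⟨ sym (D₁.Dist⇒≡dist dist₁) ⟩
    k₁        ∎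
  where
    open ≡-Reasoning
    open TwoTrees T₀ T₁ tree₀ tree₁ using (module D₀; module D₁; δ₀; δ₁)

    3≤n : 3 ≤ n
    3≤n = ≤-trans (s≤s (s≤s (s≤s z≤n))) 13≤n

    disagreements : ∀ {T T′} (tree : IsTree T) (tree′ : IsTree T′) →
                    Consistent Q H T → Consistent Q H T′ → TwoTrees.AtMostTwoDisagreements T T′ tree tree′
    disagreements = Queries.at-most-two-disagreements Q H 3≤n min-degree H-connected

    δ₁≤δ₀ : δ₁ b v ≤ δ₀ b v
    δ₁≤δ₀ = TwoTrees.Configuration.δ₁b≤δ₀b T₀ T₁ tree₀ tree₁
              (disagreements tree₀ tree₁ consistent₀ consistent₁)
              a≢c b≢d e₀ab e₀bc e₀cd e₁da e₁ab e₁bc v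

    δ₀≤δ₁ : δ₀ b v ≤ δ₁ b v
    δ₀≤δ₁ = TwoTrees.Configuration.δ₁b≤δ₀b T₁ T₀ tree₁ tree₀
              (disagreements tree₁ tree₀ consistent₁ consistent₀)
              (a≢c ∘ sym) b≢d (Edge₁-sym e₁bc) (Edge₁-sym e₁ab) (Edge₁-sym e₁da)
              (Edge₀-sym e₀cd) (Edge₀-sym e₀bc) (Edge₀-sym e₀ab) v
      where
        open Walks T₀ using () renaming (Edge-sym to Edge₀-sym)
        open Walks T₁ using () renaming (Edge-sym to Edge₁-sym)
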